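{- Let $G=(V^+,V^-;E)$ be a bipartite graph with $|V^+|<|V^-|$. Let $F\subseteq(V^+\times V^-)\setminus E$ be any edge set such that $G+F$ is DM-irreducible, and let $\mathcal X^+$ be any subpartition of $V^+$. Then \[|F|\ge\tau_G(\mathcal X^+):=\sum_{X\in\mathcal X^+}\bigl(|X|-|\Gamma_G(X)|+1\bigr).\]
   Context: A bipartite graph $G=(V^+,V^-;E)$ has finite disjoint vertex sides $V^+,V^-$, and its edge set satisfies $E\subseteq V^+\times V^-$. For $X\subseteq V^+$, $\Gamma_G(X)\subseteq V^-$ is the set of vertices adjacent to some vertex of $X$. $G+F=(V^+,V^-;E\cup F)$. DM-decomposition. Define $f_G(X)=|\Gamma_G(X)|-|X|$ for $X\subseteq V^+$. Its minimizers form a lattice under union and intersection. Take a maximal chain $X_0\subsetneq\cdots\subsetneq X_k$ of minimizers and set: - $V_0=X_0\cup\Gamma_G(X_0)$; - $V_i=(X_i\setminus X_{i-1})\cup(\Gamma_G(X_i)\setminus\Gamma_G(X_{i-1}))$ for $i=1,\dots,k$; - $V_\infty=(V^+\setminus X_k)\cup(V^-\setminus\Gamma_G(X_k))$. This partition of $V=V^+\cup V^-$ is independent of the chain. $G$ is DM-irreducible if exactly one part is nonempty, i.e. $V_0=V$, or $V_1=V$, or $V_\infty=V$. A subpartition of a set $S$ is a family of pairwise disjoint nonempty subsets of $S$. -}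

module Defs where

open import Data.Nat using (ℕ; zero; suc)
open import Data.Integer using (ℤ; +_; _-_; _+_; _≤_)
open import Data.Fin using (Fin; zero; suc; inject₁)
open import Data.Fin.Subset
  using (Subset; ⊥; _∪_; _─_; ∁; ∣_∣; _∈_; _∉_; _⊆_; _⊂_; Nonempty; Empty; _∩_)
open import Data.Vec using ([]; _∷_)
open import Data.Bool using (true; false)
open import Data.Product using (Σ; ∃; _×_; _,_)
open import Data.Sum using (_⊎_)
open import Data.Unit using (⊤)
open import Relation.Binary.PropositionalEquality using (_≡_)
open import Relation.Nullary using (¬_)

-- A bipartite graph with V⁺ = Fin p and V⁻ = Fin q is given by its
-- edge set E ⊆ V⁺ × V⁻, represented by the neighbourhoods E i ⊆ V⁻.
EdgeSet : ℕ → ℕ → Set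
EdgeSet p q = Fin p → Subset q

sumℕ : ∀ {r} → (Fin r → ℕ) → ℕ
sumℕ {zero} f = 0
sumℕ {suc r} f = f zero Data.Nat.+ sumℕ (λ i → f (suc i))

sumℤ : ∀ {r} → (Fin r → ℤ) → ℤ
sumℤ {zero} f = + 0
sumℤ {suc r} f = f zero + sumℤ (λ i → f (suc i))

card : ∀ {p q} → EdgeSet p q → ℕ
card E = sumℕ (λ i → ∣ E i ∣)

_⊕_ : ∀ {p q} → EdgeSet p q → EdgeSet p q → EdgeSet p q
(E ⊕ F) i = E i ∪ F i

DisjointEdges : ∀ {p q} → EdgeSet p q → EdgeSet p q → Set
DisjointEdges E F = ∀ i j → j ∈ F i → j ∉ E i

Γ : ∀ {p q} → EdgeSet p q → Subset p → Subset q
Γ {zero}  E []          = ⊥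
Γ {suc p} E (true ∷ X)  = E zero ∪ Γ (λ i → E (suc i)) X
Γ {suc p} E (false ∷ X) = Γ (λ i → E (suc i)) X

fG : ∀ {p q} → EdgeSet p q → Subset p → ℤ
fG E X = + ∣ Γ E X ∣ - + ∣ X ∣

Minimizer : ∀ {p q} → EdgeSet p q → Subset p → Set
Minimizer E X = ∀ Y → fG E X ≤ fG E Y

record MaxChain {p q} (E : EdgeSet p q) (k : ℕ) : Set where
  field
    X        : Fin (suc k) → Subset p
    minimal  : ∀ i → Minimizer E (X i)
    strict   : ∀ (i : Fin k) → X (inject₁ i) ⊂ X (suc i)
    maximal  : ∀ Y → Minimizer E Y →
               (∀ i → (Y ⊆ X i) ⊎ (X i ⊆ Y)) → ∃ λ i → Y ≡ X i

-- Parts of the DM-decomposition: V₀, V₁, …, V_k, and V_∞.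
-- A part is a pair (part of V⁺ , part of V⁻).
data PartIx (k : ℕ) : Set where
  fin : Fin (suc k) → PartIx k
  ∞   : PartIx k

lastFin : ∀ k → Fin (suc k)
lastFin zero = zero
lastFin (suc k) = suc (lastFin k)

part : ∀ {p q} {E : EdgeSet p q} {k} → MaxChain E k → PartIx k →
       Subset p × Subset q
part {E = E} C (fin zero) = X zero , Γ E (X zero)
  where open MaxChain C
part {E = E} C (fin (suc i)) =
  (X (suc i) ─ X (inject₁ i)) , (Γ E (X (suc i)) ─ Γ E (X (inject₁ i)))
  where open MaxChain C
part {E = E} {k} C ∞ = ∁ (X (lastFin k)) , ∁ (Γ E (X (lastFin k)))
  where open MaxChain C

NonemptyPart : ∀ {p q} → Subset p × Subset q → Set
NonemptyPart (A , B) = Nonempty A ⊎ Nonempty B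

-- DM-irreducible: for a maximal chain of minimizers, exactly one part of
-- the resulting decomposition is nonempty (the partition is independent
-- of the chain).
DMIrreducible : ∀ {p q} → EdgeSet p q → Set
DMIrreducible E =
  Σ ℕ λ k → Σ (MaxChain E k) λ C →
    Σ (PartIx k) λ a → NonemptyPart (part C a) ×
      (∀ b → NonemptyPart (part C b) → b ≡ a)

Subpartition : ∀ p r → (Fin r → Subset p) → Set
Subpartition p r 𝒳 =
  (∀ i → Nonempty (𝒳 i)) × (∀ i j → ¬ i ≡ j → Empty (𝒳 i ∩ 𝒳 j))

τ : ∀ {p q r} → EdgeSet p q → (Fin r → Subset p) → ℤ
τ E 𝒳 = sumℤ (λ i → + ∣ 𝒳 i ∣ - + ∣ Γ E (𝒳 i) ∣ + + 1)

module Submission where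

-- Write H = G + F.  Because |V⁺| < |V⁻|, the last part V_∞ of the
-- DM-decomposition of H is nonempty (otherwise Γ_H(X_k) = V⁻ and
-- f_H(X_k) ≥ |V⁻| - |V⁺| > 0 = f_H(∅), so X_k would not be a minimizer).
-- DM-irreducibility therefore forces V = V_∞: the maximal chain consists of
-- the single minimizer X₀ = ∅.  By maximality no nonempty Y is a minimizer,
-- i.e. H has positive surplus: |Γ_H(Y)| ≥ |Y| + 1 for all Y ≠ ∅.
-- Since Γ_H(Y) = Γ_G(Y) ∪ Γ_F(Y) and |Γ_F(Y)| is at most the number of
-- F-edges leaving Y, every part X of the subpartition contributes
-- |X| - |Γ_G(X)| + 1 ≤ (F-edges leaving X); summing over the pairwise
-- disjoint parts bounds τ_G(𝒳⁺) by |F|.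

open import Defs
open import Data.Nat using (ℕ; _<_)
open import Data.Integer using (+_; _≤_)
open import Data.Fin using (Fin)
open import Data.Fin.Subset using (Subset)

open import Data.Nat as ℕ using (zero; suc; _+_; z≤n; s≤s)
import Data.Nat.Properties as ℕₚ
open import Algebra.Properties.CommutativeSemigroup ℕₚ.+-commutativeSemigroup
  using (x∙yz≈y∙xz)
open import Data.Integer as ℤ using (ℤ; 0ℤ; _-_; +≤+)
import Data.Integer.Properties as ℤₚ
open import Data.Integer.Tactic.RingSolver using (solve-∀)
open import Data.Fin using (zero; suc)
open import Data.Fin.Subset
  using (⊥; ⊤; _∪_; _∩_; ∁; ∣_∣; _∈_; _⊆_; Nonempty; Empty)
open import Data.Fin.Subset.Properties
  using ( ∉⊥; ⊥⊆; ∣⊥∣≡0; ∣⊤∣≡n; ∣p∣≤n; p⊆q⇒∣p∣≤∣q∣; x∉∁p⇒x∈p; Empty-unique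
        ; drop-∷-Empty; nonempty?; x∈p∪q⁻; x∈p∩q⁻; x∈p∩q⁺; x∈p∧x∉q⇒x∈p─q
        ; ∪-identityʳ; ∪-commutativeMonoid )
open import Algebra.Bundles using (CommutativeMonoid)
open import Data.Vec.Base using ([]; _∷_; here)
open import Data.Bool using (true; false)
open import Data.Product using (∃; _,_)
open import Data.Sum using (inj₁; inj₂)
open import Data.Empty using (⊥-elim)
open import Relation.Binary.PropositionalEquality
  using (_≡_; refl; sym; trans; cong; cong₂; subst; module ≡-Reasoning)
open import Relation.Nullary using (¬_; yes; no)

weight : ∀ {p} → (Fin p → ℕ) → Subset p → ℕ
weight c []          = 0
weight c (true ∷ A)  = c zero + weight (λ i → c (suc i)) A
weight c (false ∷ A) = weight (λ i → c (suc i)) A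

weight-⊥ : ∀ {p} (c : Fin p → ℕ) → weight c ⊥ ≡ 0
weight-⊥ {zero}  c = refl
weight-⊥ {suc p} c = weight-⊥ (λ i → c (suc i))

weight≤sum : ∀ {p} (c : Fin p → ℕ) (A : Subset p) → weight c A ℕ.≤ sumℕ c
weight≤sum c []          = z≤n
weight≤sum c (true ∷ A)  = ℕₚ.+-monoʳ-≤ (c zero) (weight≤sum _ A)
weight≤sum c (false ∷ A) = ℕₚ.≤-trans (weight≤sum _ A) (ℕₚ.m≤n+m _ (c zero))

weight-∪ : ∀ {p} (c : Fin p → ℕ) (A B : Subset p) → Empty (A ∩ B) →
           weight c (A ∪ B) ≡ weight c A + weight c B
weight-∪ c []          []          _    = refl
weight-∪ c (true ∷ A)  (true ∷ B)  disj = ⊥-elim (disj (zero , here))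
weight-∪ c (true ∷ A)  (false ∷ B) disj =
  trans (cong (_+_ (c zero)) (weight-∪ _ A B (drop-∷-Empty disj)))
        (sym (ℕₚ.+-assoc (c zero) _ _))
weight-∪ c (false ∷ A) (true ∷ B)  disj =
  trans (cong (_+_ (c zero)) (weight-∪ _ A B (drop-∷-Empty disj)))
        (x∙yz≈y∙xz (c zero) (weight _ A) (weight _ B))
weight-∪ c (false ∷ A) (false ∷ B) disj = weight-∪ _ A B (drop-∷-Empty disj)

⋃ : ∀ {p r} → (Fin r → Subset p) → Subset p
⋃ {r = zero}  𝒳 = ⊥
⋃ {r = suc r} 𝒳 = 𝒳 zero ∪ ⋃ (λ j → 𝒳 (suc j))

∈⋃⁻ : ∀ {p r} (𝒳 : Fin r → Subset p) {x} → x ∈ ⋃ 𝒳 → ∃ λ j → x ∈ 𝒳 j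
∈⋃⁻ {r = zero}  𝒳 x∈ = ⊥-elim (∉⊥ x∈)
∈⋃⁻ {r = suc r} 𝒳 x∈ with x∈p∪q⁻ (𝒳 zero) _ x∈
... | inj₁ x∈𝒳₀ = zero , x∈𝒳₀
... | inj₂ x∈⋃ with ∈⋃⁻ (λ j → 𝒳 (suc j)) x∈⋃
...   | j , x∈𝒳ⱼ = suc j , x∈𝒳ⱼ

PairwiseDisjoint : ∀ {p r} → (Fin r → Subset p) → Set
PairwiseDisjoint 𝒳 = ∀ i j → ¬ i ≡ j → Empty (𝒳 i ∩ 𝒳 j)

weight-⋃ : ∀ {p r} (c : Fin p → ℕ) (𝒳 : Fin r → Subset p) →
           PairwiseDisjoint 𝒳 → sumℕ (λ j → weight c (𝒳 j)) ≡ weight c (⋃ 𝒳)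
weight-⋃ {r = zero}  c 𝒳 _    = sym (weight-⊥ c)
weight-⋃ {r = suc r} c 𝒳 disj = begin
  weight c (𝒳 zero) + sumℕ (λ j → weight c (𝒳 (suc j)))
    ≡⟨ cong (_+_ (weight c (𝒳 zero))) (weight-⋃ c 𝒳₊ disj₊) ⟩
  weight c (𝒳 zero) + weight c (⋃ 𝒳₊)
    ≡⟨ sym (weight-∪ c (𝒳 zero) (⋃ 𝒳₊) head-disjoint) ⟩
  weight c (⋃ 𝒳) ∎
  where
  open ≡-Reasoning
  𝒳₊ : Fin r → Subset _
  𝒳₊ j = 𝒳 (suc j)
  disj₊ : PairwiseDisjoint 𝒳₊
  disj₊ i j i≢j = disj (suc i) (suc j) (λ { refl → i≢j refl })
  head-disjoint : Empty (𝒳 zero ∩ ⋃ 𝒳₊)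
  head-disjoint (x , x∈) with x∈p∩q⁻ (𝒳 zero) _ x∈
  ... | x∈𝒳₀ , x∈⋃ with ∈⋃⁻ 𝒳₊ x∈⋃
  ...   | j , x∈𝒳ⱼ = disj zero (suc j) (λ ()) (x , x∈p∩q⁺ (x∈𝒳₀ , x∈𝒳ⱼ))

sumℤ-mono : ∀ {r} {f g : Fin r → ℤ} → (∀ i → f i ≤ g i) → sumℤ f ≤ sumℤ g
sumℤ-mono {zero}  f≤g = ℤₚ.≤-refl
sumℤ-mono {suc r} f≤g = ℤₚ.+-mono-≤ (f≤g zero) (sumℤ-mono (λ i → f≤g (suc i)))

sumℤ-+ : ∀ {r} (g : Fin r → ℕ) → sumℤ (λ i → + g i) ≡ + sumℕ g
sumℤ-+ {zero}  g = refl
sumℤ-+ {suc r} g = cong (ℤ._+_ (+ g zero)) (sumℤ-+ (λ i → g (suc i)))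

deficiency≤ : ∀ a b c → suc a ℕ.≤ b + c → + a - + b ℤ.+ + 1 ≤ + c
deficiency≤ a b c a<b+c = ℤₚ.i-j≤0⇒i≤j (begin
  (+ a - + b ℤ.+ + 1) - + c      ≡⟨ rearrange (+ a) (+ b) (+ c) ⟩
  (+ 1 ℤ.+ + a) - (+ b ℤ.+ + c)  ≤⟨ ℤₚ.i≤j⇒i-j≤0 (+≤+ a<b+c) ⟩
  0ℤ                             ∎)
  where
  open ℤₚ.≤-Reasoning
  rearrange : ∀ a b c → (a - b ℤ.+ + 1) - c ≡ (+ 1 ℤ.+ a) - (b ℤ.+ c)
  rearrange = solve-∀

∣∪∣≤ : ∀ {n} (A B : Subset n) → ∣ A ∪ B ∣ ℕ.≤ ∣ A ∣ + ∣ B ∣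
∣∪∣≤ []          []          = z≤n
∣∪∣≤ (true ∷ A)  (true ∷ B)  = s≤s (ℕₚ.≤-trans (∣∪∣≤ A B) (ℕₚ.+-monoʳ-≤ ∣ A ∣ (ℕₚ.n≤1+n _)))
∣∪∣≤ (true ∷ A)  (false ∷ B) = s≤s (∣∪∣≤ A B)
∣∪∣≤ (false ∷ A) (true ∷ B)  = ℕₚ.≤-trans (s≤s (∣∪∣≤ A B)) (ℕₚ.≤-reflexive (sym (ℕₚ.+-suc ∣ A ∣ ∣ B ∣)))
∣∪∣≤ (false ∷ A) (false ∷ B) = ∣∪∣≤ A B

Γ-⊥ : ∀ {p q} (E : EdgeSet p q) → Γ E ⊥ ≡ ⊥
Γ-⊥ {zero}  E = refl
Γ-⊥ {suc p} E = Γ-⊥ (λ i → E (suc i))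

Γ-⊕ : ∀ {p q} (E F : EdgeSet p q) (Y : Subset p) → Γ (E ⊕ F) Y ≡ Γ E Y ∪ Γ F Y
Γ-⊕ {zero}      E F []          = sym (∪-identityʳ ⊥)
Γ-⊕ {suc p} {q} E F (true ∷ Y)  =
  trans (cong ((E zero ∪ F zero) ∪_) (Γ-⊕ (λ i → E (suc i)) (λ i → F (suc i)) Y))
        (interchange (E zero) (F zero) _ _)
  where open import Algebra.Properties.CommutativeSemigroup
          (CommutativeMonoid.commutativeSemigroup (∪-commutativeMonoid q))
          using (interchange)
Γ-⊕ {suc p} E F (false ∷ Y) = Γ-⊕ (λ i → E (suc i)) (λ i → F (suc i)) Y

degree : ∀ {p q} → EdgeSet p q → Subset p → ℕ
degree F = weight (λ i → ∣ F i ∣)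

∣Γ∣≤degree : ∀ {p q} (F : EdgeSet p q) (Y : Subset p) → ∣ Γ F Y ∣ ℕ.≤ degree F Y
∣Γ∣≤degree {zero} {q} F []  = ℕₚ.≤-reflexive (∣⊥∣≡0 q)
∣Γ∣≤degree F (true ∷ Y)  =
  ℕₚ.≤-trans (∣∪∣≤ (F zero) _) (ℕₚ.+-monoʳ-≤ ∣ F zero ∣ (∣Γ∣≤degree (λ i → F (suc i)) Y))
∣Γ∣≤degree F (false ∷ Y) = ∣Γ∣≤degree (λ i → F (suc i)) Y

fG-⊥ : ∀ {p q} (H : EdgeSet p q) → fG H ⊥ ≡ 0ℤ
fG-⊥ {p} {q} H = cong₂ (λ a b → + a - + b) (trans (cong ∣_∣ (Γ-⊥ H)) (∣⊥∣≡0 q)) (∣⊥∣≡0 p)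

deficient⇒fG≤0 : ∀ {p q} (H : EdgeSet p q) {Y} → ∣ Γ H Y ∣ ℕ.≤ ∣ Y ∣ → fG H Y ≤ 0ℤ
deficient⇒fG≤0 H ΓY≤Y = ℤₚ.i≤j⇒i-j≤0 (+≤+ ΓY≤Y)

fG≤0⇒deficient : ∀ {p q} (H : EdgeSet p q) {Y} → fG H Y ≤ 0ℤ → ∣ Γ H Y ∣ ℕ.≤ ∣ Y ∣
fG≤0⇒deficient H fY≤0 = ℤₚ.drop‿+≤+ (ℤₚ.i-j≤0⇒i≤j fY≤0)

-- A minimizer is deficient, since it does at least as well as ∅.
minimizer⇒deficient : ∀ {p q} (H : EdgeSet p q) {X} → Minimizer H X → ∣ Γ H X ∣ ℕ.≤ ∣ X ∣
minimizer⇒deficient H min =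
  fG≤0⇒deficient H (ℤₚ.≤-trans (min ⊥) (ℤₚ.≤-reflexive (fG-⊥ H)))

deficient⇒minimizer : ∀ {p q} (H : EdgeSet p q) {Y} → Minimizer H ⊥ →
                      ∣ Γ H Y ∣ ℕ.≤ ∣ Y ∣ → Minimizer H Y
deficient⇒minimizer H {Y} ⊥-min ΓY≤Y Z = begin
  fG H Y ≤⟨ deficient⇒fG≤0 H ΓY≤Y ⟩
  0ℤ     ≡⟨ sym (fG-⊥ H) ⟩
  fG H ⊥ ≤⟨ ⊥-min Z ⟩
  fG H Z ∎
  where open ℤₚ.≤-Reasoning

PositiveSurplus : ∀ {p q} → EdgeSet p q → Set
PositiveSurplus {p} H = ∀ (Y : Subset p) → Nonempty Y → suc ∣ Y ∣ ℕ.≤ ∣ Γ H Y ∣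

∁-empty⇒full : ∀ {n} (A : Subset n) → Empty (∁ A) → n ℕ.≤ ∣ A ∣
∁-empty⇒full {n} A ∁A-empty =
  ℕₚ.≤-trans (ℕₚ.≤-reflexive (sym (∣⊤∣≡n n)))
             (p⊆q⇒∣p∣≤∣q∣ {p = ⊤} λ {x} _ → x∉∁p⇒x∈p λ x∈∁A → ∁A-empty (x , x∈∁A))

-- When |V⁺| < |V⁻| the part V_∞ is nonempty: if Γ_H(X_k) = V⁻ then
-- |X_k| ≥ |Γ_H(X_k)| = |V⁻| > |V⁺|, which is impossible.
V∞-nonempty : ∀ {p q} {H : EdgeSet p q} {k} → p < q →
              (C : MaxChain H k) → NonemptyPart (part C ∞)
V∞-nonempty {p} {q} {H} {k} p<q C with nonempty? (∁ (Γ H (MaxChain.X C (lastFin k))))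
... | yes ∁ΓXₖ-nonempty = inj₂ ∁ΓXₖ-nonempty
... | no  ∁ΓXₖ-empty    = ⊥-elim (ℕₚ.<⇒≱ p<q (begin
  q          ≤⟨ ∁-empty⇒full (Γ H Xₖ) ∁ΓXₖ-empty ⟩
  ∣ Γ H Xₖ ∣ ≤⟨ minimizer⇒deficient H (minimal (lastFin k)) ⟩
  ∣ Xₖ ∣     ≤⟨ ∣p∣≤n Xₖ ⟩
  p          ∎))
  where
  open MaxChain C
  open ℕₚ.≤-Reasoning
  Xₖ : Subset p
  Xₖ = X (lastFin k)

successor-part-nonempty : ∀ {p q} {H : EdgeSet p q} {k} (C : MaxChain H k) (i : Fin k) →
                          NonemptyPart (part C (fin (suc i)))
successor-part-nonempty C i with MaxChain.strict C i
... | _ , x , x∈Xᵢ₊₁ , x∉Xᵢ = inj₁ (x , x∈p∧x∉q⇒x∈p─q x∈Xᵢ₊₁ x∉Xᵢ)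

-- If the maximal chain is the single minimizer ∅, then ∅ is the only
-- minimizer: every minimizer is comparable with ∅, so maximality applies.
trivial-chain⇒unique-minimizer : ∀ {p q} {H : EdgeSet p q} (C : MaxChain H 0) →
  MaxChain.X C zero ≡ ⊥ → ∀ {Y} → Minimizer H Y → Y ≡ ⊥
trivial-chain⇒unique-minimizer C X₀≡⊥ {Y} Y-min
  with MaxChain.maximal C Y Y-min (λ { zero → inj₂ X₀⊆Y })
  where
  X₀⊆Y : MaxChain.X C zero ⊆ Y
  X₀⊆Y = subst (_⊆ Y) (sym X₀≡⊥) ⊥⊆
... | zero , Y≡X₀ = trans Y≡X₀ X₀≡⊥

-- Consequently H has positive surplus: a deficient nonempty Y would be a
-- second minimizer.
trivial-chain⇒positiveSurplus : ∀ {p q} {H : EdgeSet p q} (C : MaxChain H 0) →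
                                MaxChain.X C zero ≡ ⊥ → PositiveSurplus H
trivial-chain⇒positiveSurplus {H = H} C X₀≡⊥ Y (y , y∈Y) with suc ∣ Y ∣ ℕ.≤? ∣ Γ H Y ∣
... | yes surplus = surplus
... | no  ¬surplus = ⊥-elim (∉⊥ (subst (y ∈_) Y≡⊥ y∈Y))
  where
  ⊥-minimizer : Minimizer H ⊥
  ⊥-minimizer = subst (Minimizer H) X₀≡⊥ (MaxChain.minimal C zero)
  Y≡⊥ : Y ≡ ⊥
  Y≡⊥ = trivial-chain⇒unique-minimizer C X₀≡⊥
          (deficient⇒minimizer H ⊥-minimizer (ℕₚ.≤-pred (ℕₚ.≰⇒> ¬surplus)))

-- The key consequence of DM-irreducibility when |V⁺| < |V⁻|: the only
-- nonempty part is V_∞, so the chain is the single minimizer X₀ = ∅.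
irreducible⇒positiveSurplus : ∀ {p q} {H : EdgeSet p q} → p < q →
                              DMIrreducible H → PositiveSurplus H
irreducible⇒positiveSurplus p<q (k , C , fin i , _ , onlyPart)
  with onlyPart ∞ (V∞-nonempty p<q C)
... | ()
irreducible⇒positiveSurplus p<q (suc k , C , ∞ , _ , onlyPart)
  with onlyPart (fin (suc zero)) (successor-part-nonempty C zero)
... | ()
irreducible⇒positiveSurplus p<q (zero , C , ∞ , _ , onlyPart) =
  trivial-chain⇒positiveSurplus C (Empty-unique λ X₀-nonempty → V₀-empty (inj₁ X₀-nonempty))
  where
  V₀-empty : ¬ NonemptyPart (part C (fin zero))
  V₀-empty V₀-nonempty with onlyPart (fin zero) V₀-nonempty
  ... | ()

τ-term≤degree : ∀ {p q} (E F : EdgeSet p q) → PositiveSurplus (E ⊕ F) →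
                ∀ {Y} → Nonempty Y → + ∣ Y ∣ - + ∣ Γ E Y ∣ ℤ.+ + 1 ≤ + degree F Y
τ-term≤degree E F surplus {Y} Y-nonempty = deficiency≤ ∣ Y ∣ ∣ Γ E Y ∣ (degree F Y) (begin
  suc ∣ Y ∣                 ≤⟨ surplus Y Y-nonempty ⟩
  ∣ Γ (E ⊕ F) Y ∣           ≡⟨ cong ∣_∣ (Γ-⊕ E F Y) ⟩
  ∣ Γ E Y ∪ Γ F Y ∣         ≤⟨ ∣∪∣≤ (Γ E Y) (Γ F Y) ⟩
  ∣ Γ E Y ∣ + ∣ Γ F Y ∣     ≤⟨ ℕₚ.+-monoʳ-≤ ∣ Γ E Y ∣ (∣Γ∣≤degree F Y) ⟩
  ∣ Γ E Y ∣ + degree F Y    ∎)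
  where open ℕₚ.≤-Reasoning

corollaryA1 : (p q : ℕ) → p < q → (E F : EdgeSet p q) →
    DisjointEdges E F → DMIrreducible (E ⊕ F) →
    (r : ℕ) (𝒳 : Fin r → Subset p) → Subpartition p r 𝒳 →
    τ E 𝒳 ≤ + card F
corollaryA1 p q p<q E F _ irreducible r 𝒳 (nonempty , disjoint) = begin
  τ E 𝒳                                 ≤⟨ sumℤ-mono (λ j → τ-term≤degree E F surplus (nonempty j)) ⟩
  sumℤ (λ j → + degree F (𝒳 j))        ≡⟨ sumℤ-+ (λ j → degree F (𝒳 j)) ⟩
  + sumℕ (λ j → degree F (𝒳 j))        ≡⟨ cong +_ (weight-⋃ (λ i → ∣ F i ∣) 𝒳 disjoint) ⟩
  + degree F (⋃ 𝒳)                      ≤⟨ +≤+ (weight≤sum (λ i → ∣ F i ∣) (⋃ 𝒳)) ⟩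
  + card F                              ∎
  where
  open ℤₚ.≤-Reasoning
  surplus : PositiveSurplus (E ⊕ F)
  surplus = irreducible⇒positiveSurplus p<q irreducible
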